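{- Let $\mathbf P=(P,\leq,{}',0,1)$ be an orthogonal lub-complete poset. Then the following conditions are equivalent: (i) $\mathbf P$ is a Boolean algebra; (ii) for all $x,y\in P$: $x\leq y$ if and only if $x\rightarrow_C y=\{1\}$; (iii) $\mathbf P$ is orthocomplemented and there exists a binary operator $\odot_C\colon P^2\to 2^P$ such that for all $x,y,z\in P$: $x\odot_C y\leq_1 \{z\}$ if and only if $\{x\}\leq_2 y\rightarrow_C z$.
   Context: For a poset $(P,\leq)$ and $A\subseteq P$: $L(A)=\{x: x\leq a\ \forall a\in A\}$, $U(A)=\{x: a\leq x\ \forall a\in A\}$, $U(x,y)=U(\{x,y\})$; $\operatorname{Min}A$ is the set of minimal elements of $A$. For $A,B\subseteq P$: $A\leq_1 B$ iff for every $x\in A$ there is $y\in B$ with $x\leq y$; $A\leq_2 B$ iff for every $y\in B$ there is $x\in A$ with $x\leq y$. A bounded poset $(P,\leq,{}',0,1)$ with antitone involution: $x\leq y\Rightarrow y'\leq x'$, $x''=x$. $x\perp y$ iff $x\leq y'$. Orthogonal: $x\perp y$ implies the supremum $x\vee y$ exists. Lub-complete: for every finite $M\subseteq P$ and lower bound $x$ of $M$ there is a maximal element of $L(M)$ above $x$. Orthocomplemented: $x\vee x'=1$ for every $x$. Boolean algebra: $(P,\leq)$ is a distributive lattice with ${}'$ as complementation. Classical implication: $x\rightarrow_C y=\operatorname{Min}U(x',y)$. -}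

module Defs where

open import Level using (Level; suc; _⊔_)
open import Data.Product using (Σ; _×_; _,_; ∃)
open import Data.List using (List)
open import Data.List.Membership.Propositional using (_∈_)
open import Relation.Binary.PropositionalEquality using (_≡_)
open import Relation.Binary.Structures using (IsPartialOrder)
open import Relation.Unary using (Pred)

record BPAI (ℓ : Level) : Set (suc ℓ) where
  field
    Carrier : Set ℓ
    _≤_     : Carrier → Carrier → Set ℓ
    isPartialOrder : IsPartialOrder _≡_ _≤_
    _′      : Carrier → Carrier
    𝟘 𝟙     : Carrier
    𝟘-min   : ∀ x → 𝟘 ≤ x
    𝟙-max   : ∀ x → x ≤ 𝟙
    antitone : ∀ {x y} → x ≤ y → (y ′) ≤ (x ′)
    involutive : ∀ x → ((x ′) ′) ≡ x

module _ {ℓ : Level} (P : BPAI ℓ) where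
  open BPAI P

  Subset : Set (suc ℓ)
  Subset = Pred Carrier ℓ

  ⟦_⟧ : Carrier → Subset
  ⟦ x ⟧ = λ z → z ≡ x

  Lo : Subset → Subset
  Lo A = λ x → ∀ a → A a → x ≤ a

  Up : Subset → Subset
  Up A = λ x → ∀ a → A a → a ≤ x

  U2 : Carrier → Carrier → Subset
  U2 x y = λ z → x ≤ z × y ≤ z

  Min : Subset → Subset
  Min A = λ x → A x × (∀ y → A y → y ≤ x → y ≡ x)

  Max : Subset → Subset
  Max A = λ x → A x × (∀ y → A y → x ≤ y → y ≡ x)

  _≤₁_ : Subset → Subset → Set ℓ
  A ≤₁ B = ∀ x → A x → Σ Carrier λ y → B y × x ≤ y

  _≤₂_ : Subset → Subset → Set ℓ
  A ≤₂ B = ∀ y → B y → Σ Carrier λ x → A x × x ≤ y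

  _≐_ : Subset → Subset → Set ℓ
  A ≐ B = (∀ x → A x → B x) × (∀ x → B x → A x)

  IsSup : Carrier → Carrier → Carrier → Set ℓ
  IsSup x y s = x ≤ s × y ≤ s × (∀ z → x ≤ z → y ≤ z → s ≤ z)

  IsInf : Carrier → Carrier → Carrier → Set ℓ
  IsInf x y m = m ≤ x × m ≤ y × (∀ z → z ≤ x → z ≤ y → z ≤ m)

  _⊥_ : Carrier → Carrier → Set ℓ
  x ⊥ y = x ≤ (y ′)

  Orthogonal : Set ℓ
  Orthogonal = ∀ x y → x ⊥ y → Σ Carrier λ s → IsSup x y s

  -- finite subsets M are given by lists
  LubComplete : Set ℓ
  LubComplete = ∀ (M : List Carrier) x → Lo (λ a → a ∈ M) x →
    Σ Carrier λ m → Max (Lo (λ a → a ∈ M)) m × x ≤ m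

  Orthocomplemented : Set ℓ
  Orthocomplemented = ∀ x → IsSup x (x ′) 𝟙

  -- (P, ≤) is a distributive lattice with ′ as complementation
  IsBooleanAlgebra : Set ℓ
  IsBooleanAlgebra =
    (∀ x y → Σ Carrier λ s → IsSup x y s) ×
    (∀ x y → Σ Carrier λ m → IsInf x y m) ×
    (∀ x y z a b c d → IsSup y z a → IsInf x a b → IsInf x y c → IsInf x z d → IsSup c d b) ×
    (∀ x → IsSup x (x ′) 𝟙 × IsInf x (x ′) 𝟘)

  _→C_ : Carrier → Carrier → Subset
  x →C y = Min (U2 (x ′) y)

  CondI : Set ℓ
  CondI = IsBooleanAlgebra

  CondII : Set ℓ
  CondII = ∀ x y → (x ≤ y → (x →C y) ≐ ⟦ 𝟙 ⟧) × ((x →C y) ≐ ⟦ 𝟙 ⟧ → x ≤ y)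

  CondIII : Set (suc ℓ)
  CondIII = Orthocomplemented ×
    Σ (Carrier → Carrier → Subset) λ _⊙C_ →
      ∀ x y z → ((x ⊙C y) ≤₁ ⟦ z ⟧ → ⟦ x ⟧ ≤₂ (y →C z)) ×
                (⟦ x ⟧ ≤₂ (y →C z) → (x ⊙C y) ≤₁ ⟦ z ⟧)

-- In an orthogonal lub-complete orthocomplemented poset, a Boolean algebra is forced as soon as
-- disjoint elements are orthogonal: if the only common lower bound of x and y is 0, then x ≤ y′.
-- The join a ∨ b is then the orthogonal join a ∨ m for a maximal lower bound m of a′ and b, and
-- distributivity follows by the same disjointness argument. Conditions (ii) and (iii) each imply
-- orthocomplementation and that disjoint elements are orthogonal.
-- Conversely, in a Boolean algebra x →C y = {x′ ∨ y}, so (ii) and (iii) reduce to the shunting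
-- law x ∧ y ≤ z ⇔ x ≤ y′ ∨ z.
module Submission where

open import Defs
open import Level using (Level)
open import Data.Product using (Σ; _×_; _,_; proj₁; proj₂)
open import Data.List using ([]; _∷_)
open import Data.List.Membership.Propositional using (_∈_)
open import Data.List.Relation.Unary.Any using (here; there)
open import Relation.Binary.PropositionalEquality using (_≡_; refl; sym; subst)
open import Relation.Binary.Structures using (IsPartialOrder)

module _ {ℓ : Level} (P : BPAI ℓ) where
  open BPAI P
  open IsPartialOrder isPartialOrder using (antisym; reflexive)
    renaming (refl to ≤-refl; trans to ≤-trans)

  ′′-elimˡ : ∀ {x y} → ((x ′) ′) ≤ y → x ≤ y
  ′′-elimˡ {x} {y} = subst (_≤ y) (involutive x)

  ′′-elimʳ : ∀ {x y} → x ≤ ((y ′) ′) → x ≤ y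
  ′′-elimʳ {x} {y} = subst (x ≤_) (involutive y)

  ⊥-sym : ∀ {x y} → _⊥_ P x y → _⊥_ P y x
  ⊥-sym p = ′′-elimˡ (antitone p)

  ′-swapˡ : ∀ {x y} → (x ′) ≤ y → (y ′) ≤ x
  ′-swapˡ p = ′′-elimʳ (antitone p)

  𝟙′≡𝟘 : (𝟙 ′) ≡ 𝟘
  𝟙′≡𝟘 = antisym (′-swapˡ (𝟙-max (𝟘 ′))) (𝟘-min _)

  ≤𝟘⇒≡𝟘 : ∀ {w} → w ≤ 𝟘 → w ≡ 𝟘
  ≤𝟘⇒≡𝟘 p = antisym p (𝟘-min _)

  ′≡𝟘⇒𝟙≤ : ∀ {w} → (w ′) ≡ 𝟘 → 𝟙 ≤ w
  ′≡𝟘⇒𝟙≤ e = ≤-trans (⊥-sym (𝟘-min (𝟙 ′))) (′-swapˡ (reflexive e))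

  IsSup-comm : ∀ {a b s} → IsSup P a b s → IsSup P b a s
  IsSup-comm (a≤s , b≤s , least) = b≤s , a≤s , λ z b≤z a≤z → least z a≤z b≤z

  IsInf-𝟙ʳ : ∀ x → IsInf P x 𝟙 x
  IsInf-𝟙ʳ x = ≤-refl , 𝟙-max x , λ _ z≤x _ → z≤x

  IsInf-𝟙ˡ : ∀ x → IsInf P 𝟙 x x
  IsInf-𝟙ˡ x = 𝟙-max x , ≤-refl , λ _ _ z≤x → z≤x

  IsSup-𝟘ʳ : ∀ x → IsSup P x 𝟘 x
  IsSup-𝟘ʳ x = ≤-refl , 𝟘-min x , λ _ x≤z _ → x≤z

  sup⇒Min-U2 : ∀ {a b s} → IsSup P a b s → Min P (U2 P a b) s
  sup⇒Min-U2 (a≤s , b≤s , least) =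
    (a≤s , b≤s) , λ w (a≤w , b≤w) w≤s → antisym w≤s (least w a≤w b≤w)

  Min-U2≐sup : ∀ {a b s} → IsSup P a b s → _≐_ P (Min P (U2 P a b)) (⟦_⟧ P s)
  Min-U2≐sup {s = s} sup@(a≤s , b≤s , least) =
    (λ v ((a≤v , b≤v) , minimal) → sym (minimal s (a≤s , b≤s) (least v a≤v b≤v))) ,
    λ { v refl → sup⇒Min-U2 sup }

  ≤₁⟦⟧-intro : ∀ {A z} → (∀ w → A w → w ≤ z) → _≤₁_ P A (⟦_⟧ P z)
  ≤₁⟦⟧-intro h w w∈A = _ , refl , h w w∈A

  ≤₁⟦⟧-elim : ∀ {A z w} → _≤₁_ P A (⟦_⟧ P z) → A w → w ≤ z
  ≤₁⟦⟧-elim h w∈A with h _ w∈A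
  ... | _ , refl , w≤z = w≤z

  ⟦⟧≤₂-intro : ∀ {x A} → (∀ v → A v → x ≤ v) → _≤₂_ P (⟦_⟧ P x) A
  ⟦⟧≤₂-intro h v v∈A = _ , refl , h v v∈A

  ⟦⟧≤₂-elim : ∀ {x A v} → _≤₂_ P (⟦_⟧ P x) A → A v → x ≤ v
  ⟦⟧≤₂-elim h v∈A with h _ v∈A
  ... | _ , refl , x≤v = x≤v

  Disjoint : Carrier → Carrier → Set ℓ
  Disjoint x y = ∀ w → w ≤ x → w ≤ y → w ≡ 𝟘

  DisjointOrthogonal : Set ℓ
  DisjointOrthogonal = ∀ x y → Disjoint x y → _⊥_ P x y

  ≤-from-disjoint : DisjointOrthogonal → ∀ {x y} → Disjoint x (y ′) → x ≤ y
  ≤-from-disjoint disjoint⇒⊥ {x} {y} d = ′′-elimʳ (disjoint⇒⊥ x (y ′) d)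

  disjoint⇒complements-sup : ∀ {x y} → Disjoint x y → IsSup P (x ′) (y ′) 𝟙
  disjoint⇒complements-sup d =
    𝟙-max _ , 𝟙-max _ , λ w x′≤w y′≤w → ′≡𝟘⇒𝟙≤ (d (w ′) (′-swapˡ x′≤w) (′-swapˡ y′≤w))

  module _ (oc : Orthocomplemented P) where

    complement-disjoint : ∀ x → Disjoint x (x ′)
    complement-disjoint x w w≤x w≤x′ = ≤𝟘⇒≡𝟘 (subst (w ≤_) 𝟙′≡𝟘 (⊥-sym 𝟙≤w′))
      where
      𝟙≤w′ : 𝟙 ≤ (w ′)
      𝟙≤w′ = proj₂ (proj₂ (oc x)) (w ′) (⊥-sym w≤x′) (antitone w≤x)

    complement-inf : ∀ x → IsInf P x (x ′) 𝟘
    complement-inf x =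
      𝟘-min x , 𝟘-min _ , λ w w≤x w≤x′ → reflexive (complement-disjoint x w w≤x w≤x′)

    disjoint-below-complement : ∀ {u w y} →
      (∀ v → v ≤ w → v ≤ y → v ≤ u) → w ≤ (u ′) → Disjoint w y
    disjoint-below-complement {u} below w≤u′ v v≤w v≤y =
      complement-disjoint u v (below v v≤w v≤y) (≤-trans v≤w w≤u′)

    module _ (orth : Orthogonal P) (lub : LubComplete P) (disjoint⇒⊥ : DisjointOrthogonal) where

      join : ∀ a b → Σ Carrier (IsSup P a b)
      join a b with lub ((a ′) ∷ b ∷ []) 𝟘 (λ _ _ → 𝟘-min _)
      ... | m , (m-lower , m-maximal) , _ with orth a m (⊥-sym (m-lower _ (here refl)))
      ... | s , a≤s , m≤s , s-least =
        s , a≤s , b≤s , λ z a≤z b≤z → s-least z a≤z (≤-trans m≤b b≤z)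
        where
        m≤a′ : m ≤ (a ′)
        m≤a′ = m-lower _ (here refl)

        m≤b : m ≤ b
        m≤b = m-lower _ (there (here refl))

        -- w ∨ m is again a lower bound of a′ and b, so maximality of m gives w ≤ m.
        b-disjoint-s′ : Disjoint b (s ′)
        b-disjoint-s′ w w≤b w≤s′ = complement-disjoint m w w≤m w≤m′
          where
          w≤m′ : w ≤ (m ′)
          w≤m′ = ≤-trans w≤s′ (antitone m≤s)

          w≤m : w ≤ m
          w≤m with orth w m w≤m′
          ... | t , w≤t , m≤t , t-least = subst (w ≤_) (m-maximal t t-lower m≤t) w≤t
            where
            t-lower : Lo P (_∈ ((a ′) ∷ b ∷ [])) t
            t-lower _ (here refl) = t-least _ (≤-trans w≤s′ (antitone a≤s)) m≤a′
            t-lower _ (there (here refl)) = t-least _ w≤b m≤b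
            t-lower _ (there (there ()))

        b≤s : b ≤ s
        b≤s = ≤-from-disjoint disjoint⇒⊥ b-disjoint-s′

      meet : ∀ x y → Σ Carrier (IsInf P x y)
      meet x y with join (x ′) (y ′)
      ... | s , x′≤s , y′≤s , least =
        s ′ , ′-swapˡ x′≤s , ′-swapˡ y′≤s ,
        λ z z≤x z≤y → ⊥-sym (least (z ′) (antitone z≤x) (antitone z≤y))

      distributive : ∀ x y z a b c d → IsSup P y z a → IsInf P x a b →
        IsInf P x y c → IsInf P x z d → IsSup P c d b
      distributive x y z a b c d (y≤a , z≤a , a-least) (b≤x , b≤a , b-greatest)
                   (c≤x , c≤y , c-greatest) (d≤x , d≤z , d-greatest) =
        b-greatest c c≤x (≤-trans c≤y y≤a) , b-greatest d d≤x (≤-trans d≤z z≤a) , least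
        where
        least : ∀ u → c ≤ u → d ≤ u → b ≤ u
        least u c≤u d≤u = ≤-from-disjoint disjoint⇒⊥ b-disjoint-u′
          where
          -- a part w of b outside u misses y (its part under y lies under c ≤ u) and
          -- likewise z, hence misses a ≥ w.
          b-disjoint-u′ : Disjoint b (u ′)
          b-disjoint-u′ w w≤b w≤u′ = complement-disjoint a w w≤a (⊥-sym a≤w′)
            where
            w≤x : w ≤ x
            w≤x = ≤-trans w≤b b≤x

            w≤a : w ≤ a
            w≤a = ≤-trans w≤b b≤a

            w⊥y : _⊥_ P w y
            w⊥y = disjoint⇒⊥ w y (disjoint-below-complement
              (λ v v≤w v≤y → ≤-trans (c-greatest v (≤-trans v≤w w≤x) v≤y) c≤u) w≤u′)

            w⊥z : _⊥_ P w z
            w⊥z = disjoint⇒⊥ w z (disjoint-below-complement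
              (λ v v≤w v≤z → ≤-trans (d-greatest v (≤-trans v≤w w≤x) v≤z) d≤u) w≤u′)

            a≤w′ : a ≤ (w ′)
            a≤w′ = a-least (w ′) (⊥-sym w⊥y) (⊥-sym w⊥z)

      DisjointOrthogonal⇒Boolean : IsBooleanAlgebra P
      DisjointOrthogonal⇒Boolean =
        join , meet , distributive , λ x → oc x , complement-inf x

  module _ (ba : IsBooleanAlgebra P) where
    private
      joins : ∀ x y → Σ Carrier (IsSup P x y)
      joins = proj₁ ba

      meets : ∀ x y → Σ Carrier (IsInf P x y)
      meets = proj₁ (proj₂ ba)

      distrib : ∀ x y z a b c d → IsSup P y z a → IsInf P x a b →
        IsInf P x y c → IsInf P x z d → IsSup P c d b
      distrib = proj₁ (proj₂ (proj₂ ba))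

      complemented : ∀ x → IsSup P x (x ′) 𝟙 × IsInf P x (x ′) 𝟘
      complemented = proj₂ (proj₂ (proj₂ ba))

    shuntˡ : ∀ {x y z m s} → IsInf P x y m → IsSup P (y ′) z s → m ≤ z → x ≤ s
    shuntˡ {x} {y} {z} {m} {s} x∧y=m (y′≤s , z≤s , _) m≤z with meets x (y ′)
    ... | c , x∧y′=c@(_ , c≤y′ , _) =
      proj₂ (proj₂ x-join) s (≤-trans c≤y′ y′≤s) (≤-trans m≤z z≤s)
      where
      x-join : IsSup P c m x
      x-join = distrib x (y ′) y 𝟙 x c m (IsSup-comm (proj₁ (complemented y)))
                 (IsInf-𝟙ʳ x) x∧y′=c x∧y=m

    shuntʳ : ∀ {x y z m s} → IsInf P x y m → IsSup P (y ′) z s → x ≤ s → m ≤ z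
    shuntʳ {x} {y} {z} {m} {s} (m≤x , m≤y , _) y′∨z=s x≤s
      with meets y s | meets y z
    ... | b , y∧s=b@(_ , _ , b-greatest) | d , y∧z=d@(_ , d≤z , _) =
      ≤-trans (b-greatest m m≤y (≤-trans m≤x x≤s))
              (proj₂ (proj₂ b-join) z (𝟘-min z) d≤z)
      where
      b-join : IsSup P 𝟘 d b
      b-join = distrib y (y ′) z s b 𝟘 d y′∨z=s y∧s=b (proj₂ (complemented y)) y∧z=d

    Boolean⇒CondII : CondII P
    Boolean⇒CondII x y with joins (x ′) y
    ... | s , x′∨y=s =
      (λ x≤y → subst (λ t → _≐_ P (_→C_ P x y) (⟦_⟧ P t)) (s≡𝟙 x≤y) (Min-U2≐sup x′∨y=s)) ,
      λ →C≐𝟙 → shuntʳ (IsInf-𝟙ˡ x) x′∨y=s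
                  (reflexive (sym (proj₁ →C≐𝟙 s (sup⇒Min-U2 x′∨y=s))))
      where
      s≡𝟙 : x ≤ y → s ≡ 𝟙
      s≡𝟙 x≤y = antisym (𝟙-max s) (shuntˡ (IsInf-𝟙ˡ x) x′∨y=s x≤y)

    Boolean⇒CondIII : CondIII P
    Boolean⇒CondIII = (λ x → proj₁ (complemented x)) , _⊙_ , adjoint
      where
      _⊙_ : Carrier → Carrier → Subset P
      x ⊙ y = ⟦_⟧ P (proj₁ (meets x y))

      adjoint : ∀ x y z → (_≤₁_ P (x ⊙ y) (⟦_⟧ P z) → _≤₂_ P (⟦_⟧ P x) (_→C_ P y z)) ×
                          (_≤₂_ P (⟦_⟧ P x) (_→C_ P y z) → _≤₁_ P (x ⊙ y) (⟦_⟧ P z))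
      adjoint x y z with meets x y | joins (y ′) z
      ... | m , x∧y=m | s , y′∨z=s =
        (λ m≤₁z → ⟦⟧≤₂-intro λ v v∈→C → subst (x ≤_) (sym (proj₁ (Min-U2≐sup y′∨z=s) v v∈→C))
                     (shuntˡ x∧y=m y′∨z=s (≤₁⟦⟧-elim m≤₁z refl))) ,
        λ x≤₂→C → ≤₁⟦⟧-intro λ { w refl →
                     shuntʳ x∧y=m y′∨z=s (⟦⟧≤₂-elim x≤₂→C (sup⇒Min-U2 y′∨z=s)) }

  CondII⇒Orthocomplemented : CondII P → Orthocomplemented P
  CondII⇒Orthocomplemented cond x =
    𝟙-max x , 𝟙-max _ , λ z x≤z x′≤z → reflexive (sym (𝟙-minimal z (x′≤z , x≤z) (𝟙-max z)))
    where
    𝟙-minimal : ∀ z → U2 P (x ′) x z → z ≤ 𝟙 → z ≡ 𝟙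
    𝟙-minimal = proj₂ (proj₂ (proj₁ (cond x x) ≤-refl) 𝟙 refl)

  CondII⇒DisjointOrthogonal : CondII P → DisjointOrthogonal
  CondII⇒DisjointOrthogonal cond x y d =
    proj₂ (cond x (y ′)) (Min-U2≐sup (disjoint⇒complements-sup d))

  -- Every element of x ⊙C y lies below both x and y, so for disjoint x and y, x ⊙C y ≤₁ {0}.
  CondIII⇒DisjointOrthogonal : CondIII P → DisjointOrthogonal
  CondIII⇒DisjointOrthogonal (oc , _⊙_ , adjoint) x y d =
    ⟦⟧≤₂-elim (proj₁ (adjoint x y 𝟘) ⊙≤₁𝟘) (sup⇒Min-U2 (IsSup-𝟘ʳ (y ′)))
    where
    ⊙≤ˡ : ∀ {w} → (x ⊙ y) w → w ≤ x
    ⊙≤ˡ = ≤₁⟦⟧-elim (proj₂ (adjoint x y x) (⟦⟧≤₂-intro λ v v∈→C → proj₂ (proj₁ v∈→C)))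

    ⊙≤ʳ : ∀ {w} → (x ⊙ y) w → w ≤ y
    ⊙≤ʳ = ≤₁⟦⟧-elim (proj₂ (adjoint x y y) (⟦⟧≤₂-intro λ v ((y′≤v , y≤v) , _) →
            ≤-trans (𝟙-max x) (proj₂ (proj₂ (oc y)) v y≤v y′≤v)))

    ⊙≤₁𝟘 : _≤₁_ P (x ⊙ y) (⟦_⟧ P 𝟘)
    ⊙≤₁𝟘 = ≤₁⟦⟧-intro λ w w∈⊙ → reflexive (d w (⊙≤ˡ w∈⊙) (⊙≤ʳ w∈⊙))

theorem3 : ∀ {ℓ : Level} (P : BPAI ℓ) → Orthogonal P → LubComplete P →
    ((CondI P → CondII P) × (CondII P → CondI P)) ×
    ((CondI P → CondIII P) × (CondIII P → CondI P))
theorem3 P orth lub =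
  (Boolean⇒CondII P ,
   λ ii → DisjointOrthogonal⇒Boolean P (CondII⇒Orthocomplemented P ii) orth lub
            (CondII⇒DisjointOrthogonal P ii)) ,
  (Boolean⇒CondIII P ,
   λ iii → DisjointOrthogonal⇒Boolean P (proj₁ iii) orth lub (CondIII⇒DisjointOrthogonal P iii))
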